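{- Let $P$ be a dynamic path with vertices $x_0<\dots<x_n$ (as in the context), and let $k$ be an integer with $1<k<n$ such that at least $k+1$ vertices of $P$ have positive weight. Let $$t=\max\{i:\ 0\le i<n,\ \Theta^1(P_{0,i})<\Theta^{k-1}(P_{i+1,n})\}.$$ Then (a) $0\le t<n$; (b) for all $i\le t$, $\Theta^1(P_{0,i})<\Theta^{k-1}(P_{i+1,n})$; (c) for all $i$ with $t<i<n$, $\Theta^1(P_{0,i})\ge\Theta^{k-1}(P_{i+1,n})$; (d) $\Theta^k(P)=\min\left(\Theta^1(P_{0,t+1}),\ \Theta^{k-1}(P_{t+1,n})\right)$.
   Context: A dynamic path $P$ consists of real points (vertices) $x_0<\dots<x_n$, edges $e_i=(x_{i-1},x_i)$, a constant $\tau>0$ (time to travel unit distance) with every $|x_i-x_j|\tau$ an integer, nonnegative integer weights $w_i$ (people at $x_i$) and positive integer capacities $c_i$ of $e_i$. For $a\le b$, $P_{a,b}$ is the dynamic subpath on vertices $x_a,\dots,x_b$ with the same data; $y\in P_{a,b}$ means $y\in[x_a,x_b]$. Discrete evacuation model on a path $Q$ with sink $y$: everyone moves toward $y$; time is discrete; at each vertex people wait in a FIFO queue to enter the next edge toward $y$; at each integer time step at most $c_i$ people may enter $e_i$, entering as soon as capacity and the queue permit; distance $d$ takes time $d\tau$; people starting at $y$ are evacuated at time $0$. $\Theta(Q,y)$ is the time at which all people of $Q$ have reached $y$, and $\Theta^1(Q)=\min_{y\in Q}\Theta(Q,y)$. For a subpath $Q$ and integer $m\ge1$, $\Theta^m(Q)$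 is the minimum, over all partitions of $Q$ into at most $m$ nonempty consecutive subpaths $Q_1,\dots,Q_{m'}$ ($m'\le m$) and sinks $y_j\in Q_j$, of $\max_j\Theta(Q_j,y_j)$ (this equals the minimum over partitions into exactly $m$ subpaths whenever $Q$ has at least $m$ vertices). -}

module Defs where

open import Data.Nat
open import Data.Bool using (Bool; true; false; if_then_else_)
open import Data.List using (List; []; _∷_; length)
open import Data.Product using (_×_; _,_)

-- Only the travel times of the edges matter, so instead of the real
-- points and τ we store   len i = τ (x_i - x_{i-1})   (a positive integer
-- by the hypotheses x_{i-1} < x_i, τ > 0, τ|x_i - x_j| ∈ ℤ), for 1 ≤ i ≤ n.
-- wt i = w_i (0 ≤ i ≤ n), cap i = c_i (capacity of e_i, 1 ≤ i ≤ n).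
-- Values of the functions outside these ranges are never consulted.

record DynPath (n : ℕ) : Set where
  field
    len : ℕ → ℕ
    cap : ℕ → ℕ
    wt  : ℕ → ℕ
    len-pos : ∀ i → 1 ≤ i → i ≤ n → 1 ≤ len i
    cap-pos : ∀ i → 1 ≤ i → i ≤ n → 1 ≤ cap i

-- One stream of people moving toward the sink along a chain of vertices.
-- A chain is listed NEAREST-TO-THE-SINK FIRST; each node is
-- (weight, capacity of its outgoing edge toward the sink,
--  travel time of its outgoing edge toward the sink).

Node : Set
Node = ℕ × ℕ × ℕ

-- cumulative FIFO entry count at a vertex with initial weight ω, outgoing
-- capacity κ and cumulative arrival function a:
--   F(t) = min (F(t-1) + κ) (ω + a(t)),   F(-1) = 0
cum : ℕ → ℕ → (ℕ → ℕ) → ℕ → ℕ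
cum ω κ a zero    = κ ⊓ (ω + a zero)
cum ω κ a (suc t) = (cum ω κ a t + κ) ⊓ (ω + a (suc t))

mutual
  -- Ent xs t : number of people that have entered the outgoing edge of the
  -- head vertex of xs at integer times 0..t.
  Ent : List Node → ℕ → ℕ
  Ent [] t = 0
  Ent ((ω , κ , ℓ) ∷ rest) = cum ω κ (Arr rest)

  -- Arr xs t : number of people that have arrived (through the outgoing edge
  -- of the head of xs) at the next vertex toward the sink by time t.
  Arr : List Node → ℕ → ℕ
  Arr [] t = 0
  Arr xs@((ω , κ , ℓ) ∷ rest) t = if ℓ ≤ᵇ t then Ent xs (t ∸ ℓ) else 0

totW : List Node → ℕ
totW [] = 0
totW ((ω , κ , ℓ) ∷ rest) = ω + totW rest

sumLen : List Node → ℕ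
sumLen [] = 0
sumLen ((ω , κ , ℓ) ∷ rest) = ℓ + sumLen rest

-- a safe upper bound on all completion times (capacities are ≥ 1)
bound : List Node → ℕ
bound xs = (totW xs + 1) * (length xs + 1 + sumLen xs)

-- least t < B with p t, or B if there is none
firstAt : (ℕ → Bool) → ℕ → ℕ
firstAt p zero    = zero
firstAt p (suc B) = if p zero then zero else suc (firstAt (λ t → p (suc t)) B)

arrTime : List Node → ℕ
arrTime xs = if totW xs ≡ᵇ 0 then 0
             else firstAt (λ t → totW xs ≤ᵇ Arr xs t) (bound xs)

-- last integer time at which somebody enters the outgoing edge of the head
entTime : List Node → ℕ
entTime xs = firstAt (λ t → totW xs ≤ᵇ Ent xs t) (bound xs)

-- DOUBLED completion time for a sink in the interior of the outgoing edge
-- of the head vertex, at doubled distance d from it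
stubT : List Node → ℕ → ℕ
stubT xs d = if totW xs ≡ᵇ 0 then 0 else 2 * entTime xs + d

minUpTo : (ℕ → ℕ) → ℕ → ℕ
minUpTo f zero    = f zero
minUpTo f (suc m) = minUpTo f m ⊓ f (suc m)

countPos : (ℕ → ℕ) → ℕ → ℕ
countPos f zero    = if 0 <ᵇ f zero then 1 else 0
countPos f (suc m) = countPos f m + (if 0 <ᵇ f (suc m) then 1 else 0)

-- ALL TIMES ARE DOUBLED (2·Θ), and a
-- sink y ∈ P_{a,b} is described by (j , δ): y = x_j if δ = 0, otherwise y
-- lies in the interior of e_{j+1} with τ(y - x_j) = δ/2, 0 < δ < 2·len(j+1).
-- (Only half-integer sink positions are enumerated.)

module _ {n : ℕ} (P : DynPath n) where
  open DynPath P

  -- vertex i when moving right (outgoing edge e_{i+1}) / left (edge e_i)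
  rNode lNode : ℕ → Node
  rNode i = (wt i , cap (suc i) , len (suc i))
  lNode i = (wt i , cap i , len i)

  -- vertices lo+c-1, ..., lo (moving right, nearest to sink first)
  fromLeft : ℕ → ℕ → List Node
  fromLeft lo zero    = []
  fromLeft lo (suc c) = rNode (lo + c) ∷ fromLeft lo c

  -- vertices lo, ..., lo+c-1 (moving left, nearest to sink first)
  fromRight : ℕ → ℕ → List Node
  fromRight lo zero    = []
  fromRight lo (suc c) = lNode lo ∷ fromRight (suc lo) c

  -- 2·Θ(P_{a,b}, y) for the sink y given by (j , δ), a ≤ j ≤ b
  evac : ℕ → ℕ → ℕ → ℕ → ℕ
  evac a b j δ =
    if δ ≡ᵇ 0
    then 2 * (arrTime (fromLeft a (j ∸ a)) ⊔ arrTime (fromRight (suc j) (b ∸ j)))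
    else (stubT (fromLeft a (suc (j ∸ a))) δ
          ⊔ stubT (fromRight (suc j) (b ∸ j)) (2 * len (suc j) ∸ δ))

  Θ¹ : ℕ → ℕ → ℕ
  Θ¹ a b = minUpTo (λ d → sinkMin (a + d)) (b ∸ a)
    where
    sinkMin : ℕ → ℕ
    sinkMin j = if j <ᵇ b then minUpTo (evac a b j) (2 * len (suc j) ∸ 1)
                else evac a b j 0

  -- 2·Θ^m(P_{a,b}) for m ≥ 1: min over partitions into at most m
  -- consecutive nonempty subpaths, enumerated as first part P_{a,a+d}
  -- followed by a partition of P_{a+d+1,b} into at most m-1 parts.
  -- (The case m = 0 is meaningless and is set to Θ^1; it is never used.)
  Θ : ℕ → ℕ → ℕ → ℕ
  Θ zero a b = Θ¹ a b
  Θ (suc zero) a b = Θ¹ a b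
  Θ (suc (suc m)) a b =
    if a <ᵇ b
    then Θ¹ a b ⊓ minUpTo (λ d → Θ¹ a (a + d) ⊔ Θ (suc m) (suc (a + d)) b) (b ∸ suc a)
    else Θ¹ a b

  posCount : ℕ
  posCount = countPos wt n

{-# OPTIONS --safe #-}
-- Write F i = Θ¹(P_{0,i}) and G i = Θ^{k-1}(P_{i+1,n}).  Enlarging a path never makes its
-- evacuation faster: with FIFO queues, people added farther from the sink only wait behind the
-- others, and every sink of the larger path can be traded for a sink of the smaller one that is
-- no worse.  Hence F is nondecreasing and G is nonincreasing.  Moreover F 0 = 0 < G 0: the path
-- P_{1,n} still has k vertices of positive weight, so in every partition into k-1 parts one part
-- contains two of them and one of these is at positive distance from that part's sink.  So t is
-- the last index before F and G cross, which gives (a)-(c).  Finally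
-- Θ^k(P) = min (Θ¹(P), min_{i<n} max (F i, G i)), where max (F i, G i) is G i ≥ G t for i ≤ t
-- and F i ≥ F (t+1) for i > t; this gives (d).
module Submission where

open import Data.Bool using (true; false; if_then_else_; T)
open import Data.List using ([]; _∷_; [_]; length; _++_)
open import Data.List.Properties using (length-++)
open import Data.Nat
open import Data.Nat.Properties
open import Data.Product using (Σ; _×_; _,_; ∃-syntax)
open import Data.Sum using (inj₁; inj₂)
open import Data.Unit using (tt)
open import Function using (_∘_; flip)
open import Relation.Binary.Core using (Rel)
open import Relation.Binary.Definitions using (Reflexive; Transitive; Tri; tri<; tri≈; tri>)
open import Relation.Binary.PropositionalEquality hiding ([_])
open import Relation.Nullary using (¬_; Dec; yes; no; contradiction)
open import Relation.Unary using (Decidable)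

open import Defs

-- Minima, first hitting times and counts

module _ {A : Set} {x y : A} where

  if-T : ∀ {b} → T b → (if b then x else y) ≡ x
  if-T {true} _ = refl

  if-¬T : ∀ {b} → ¬ T b → (if b then x else y) ≡ y
  if-¬T {false} _  = refl
  if-¬T {true}  ¬b = contradiction tt ¬b

1+n∸m≡1+[n∸m] : ∀ {m n} → m ≤ n → suc n ∸ m ≡ suc (n ∸ m)
1+n∸m≡1+[n∸m] = +-∸-assoc 1

n∸m≡1+[n∸1+m] : ∀ {m n} → m < n → n ∸ m ≡ suc (n ∸ suc m)
n∸m≡1+[n∸1+m] = +-∸-assoc 1

≤⇒≮+0 : ∀ {a i} → a ≤ i → ¬ (i < a + 0)
≤⇒≮+0 {a} a≤i i<a+0 = <⇒≱ (subst (_ <_) (+-identityʳ a) i<a+0) a≤i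

minUpTo-≤ : ∀ f {m d} → d ≤ m → minUpTo f m ≤ f d
minUpTo-≤ f {zero}  z≤n   = ≤-refl
minUpTo-≤ f {suc m} d≤1+m with m≤n⇒m<n∨m≡n d≤1+m
... | inj₁ d<1+m = ≤-trans (m⊓n≤m _ _) (minUpTo-≤ f (m<1+n⇒m≤n d<1+m))
... | inj₂ refl  = m⊓n≤n _ _

minUpTo-attained : ∀ f m → ∃[ d ] d ≤ m × minUpTo f m ≡ f d
minUpTo-attained f zero = 0 , z≤n , refl
minUpTo-attained f (suc m) with minUpTo-attained f m | ≤-total (minUpTo f m) (f (suc m))
... | d , d≤m , eq | inj₁ le = d , m≤n⇒m≤1+n d≤m , trans (m≤n⇒m⊓n≡m le) eq
... | _            | inj₂ ge = suc m , ≤-refl , m≥n⇒m⊓n≡n ge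

minUpTo-glb : ∀ f m {x} → (∀ {d} → d ≤ m → x ≤ f d) → x ≤ minUpTo f m
minUpTo-glb f zero    h = h z≤n
minUpTo-glb f (suc m) h = ⊓-glb (minUpTo-glb f m (h ∘ m≤n⇒m≤1+n)) (h ≤-refl)

minUpTo-mono : ∀ {f g} m → (∀ {d} → d ≤ m → f d ≤ g d) → minUpTo f m ≤ minUpTo g m
minUpTo-mono m f≤g = minUpTo-glb _ m (λ d≤m → ≤-trans (minUpTo-≤ _ d≤m) (f≤g d≤m))

firstAt-mono : ∀ p q {B B′} → B ≤ B′ → (∀ t → T (q t) → ∃[ s ] s ≤ t × T (p s)) →
               firstAt p B ≤ firstAt q B′
firstAt-mono p q {zero} _ _ = z≤n
firstAt-mono p q {suc B} {suc B′} (s≤s B≤B′) q⇒p with p 0 in p0 | q 0 in q0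
... | true  | _     = z≤n
... | false | true  = contradiction (q⇒p 0 (subst T (sym q0) tt)) ¬p0
  where
  ¬p0 : ¬ (∃[ s ] s ≤ 0 × T (p s))
  ¬p0 (.0 , z≤n , ps) = subst T p0 ps
... | false | false = s≤s (firstAt-mono (p ∘ suc) (q ∘ suc) B≤B′ q⇒p′)
  where
  q⇒p′ : ∀ t → T (q (suc t)) → ∃[ s ] s ≤ t × T (p (suc s))
  q⇒p′ t qt with q⇒p (suc t) qt
  ... | zero  , _       , ps = contradiction (subst T p0 ps) (λ ())
  ... | suc s , s≤s s≤t , ps = s , s≤t , ps

firstAt-≤ᵇ-mono : ∀ {V W} (f g : ℕ → ℕ) {B B′} → B ≤ B′ →
                  (∀ t → W ≤ g t → ∃[ s ] s ≤ t × V ≤ f s) →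
                  firstAt (λ t → V ≤ᵇ f t) B ≤ firstAt (λ t → W ≤ᵇ g t) B′
firstAt-≤ᵇ-mono {V} {W} f g B≤B′ reach =
  firstAt-mono (λ t → V ≤ᵇ f t) (λ t → W ≤ᵇ g t) B≤B′ reachᵇ
  where
  reachᵇ : ∀ t → T (W ≤ᵇ g t) → ∃[ s ] s ≤ t × T (V ≤ᵇ f s)
  reachᵇ t Wt with reach t (≤ᵇ⇒≤ W (g t) Wt)
  ... | s , s≤t , Vs = s , s≤t , ≤⇒≤ᵇ Vs

firstAt-pos : ∀ p {B} → 0 < B → p 0 ≡ false → 0 < firstAt p B
firstAt-pos p {suc B} _ p0 rewrite p0 = z<s

isPos : ℕ → ℕ
isPos v = if 0 <ᵇ v then 1 else 0

isPos≤1 : ∀ v → isPos v ≤ 1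
isPos≤1 zero    = z≤n
isPos≤1 (suc v) = ≤-refl

countPos-≥1 : ∀ (f : ℕ → ℕ) m → 1 ≤ countPos f m → ∃[ d ] d ≤ m × 0 < f d
countPos-≥1 f zero h with f 0 in f0
... | zero  = contradiction h (λ ())
... | suc _ = 0 , z≤n , subst (0 <_) (sym f0) z<s
countPos-≥1 f (suc m) h with f (suc m) in fm
... | suc _ = suc m , ≤-refl , subst (0 <_) (sym fm) z<s
... | zero with countPos-≥1 f m (subst (1 ≤_) (+-identityʳ _) h)
...   | d , d≤m , fd>0 = d , m≤n⇒m≤1+n d≤m , fd>0

countPos-≥2 : ∀ (f : ℕ → ℕ) m → 2 ≤ countPos f m → ∀ e → ∃[ d ] d ≤ m × d ≢ e × 0 < f d
countPos-≥2 f zero h e = contradiction (isPos≤1 (f 0)) (<⇒≱ h)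
countPos-≥2 f (suc m) h e with f (suc m) in fm | suc m ≟ e
... | zero | _ with countPos-≥2 f m (subst (2 ≤_) (+-identityʳ _) h) e
...   | d , d≤m , d≢e , fd>0 = d , m≤n⇒m≤1+n d≤m , d≢e , fd>0
countPos-≥2 f (suc m) h e | suc _ | no 1+m≢e = suc m , ≤-refl , 1+m≢e , subst (0 <_) (sym fm) z<s
countPos-≥2 f (suc m) h e | suc _ | yes refl
  with countPos-≥1 f m (≤-pred (subst (2 ≤_) (+-comm _ 1) h))
... | d , d≤m , fd>0 = d , m≤n⇒m≤1+n d≤m , <⇒≢ (s≤s d≤m) , fd>0

countPos-cong : ∀ {f g : ℕ → ℕ} m → (∀ e → f e ≡ g e) → countPos f m ≡ countPos g m
countPos-cong zero    f≗g = cong isPos (f≗g 0)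
countPos-cong (suc m) f≗g = cong₂ _+_ (countPos-cong m f≗g) (cong isPos (f≗g (suc m)))

countPos-split : ∀ (f : ℕ → ℕ) d r →
                 countPos f (suc (r + d)) ≡ countPos f d + countPos (λ e → f (suc (e + d))) r
countPos-split f d zero    = refl
countPos-split f d (suc r) =
  trans (cong (_+ isPos (f (suc (suc r + d)))) (countPos-split f d r)) (+-assoc (countPos f d) _ _)

-- The crossing point of a nondecreasing and a nonincreasing sequence

module _ {ℓ} (_∼_ : Rel ℕ ℓ) (∼-refl : Reflexive _∼_) (∼-trans : Transitive _∼_) (f : ℕ → ℕ) {N : ℕ}
         (step : ∀ {i} → i < N → f i ∼ f (suc i)) where

  stepwise : ∀ {i j} → i ≤ j → j ≤ N → f i ∼ f j
  stepwise {j = zero}  z≤n   _     = ∼-refl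
  stepwise {j = suc j} i≤1+j 1+j≤N with m≤n⇒m<n∨m≡n i≤1+j
  ... | inj₁ i<1+j = ∼-trans (stepwise (m<1+n⇒m≤n i<1+j) (<⇒≤ 1+j≤N)) (step 1+j≤N)
  ... | inj₂ refl  = ∼-refl

lastSatisfying : ∀ {p} {Q : ℕ → Set p} → Decidable Q → Q 0 → ∀ N →
                 ∃[ t ] t ≤ N × Q t × (∀ {i} → t < i → i ≤ N → ¬ Q i)
lastSatisfying Q? Q0 zero = 0 , z≤n , Q0 , λ 0<i i≤0 → contradiction i≤0 (<⇒≱ 0<i)
lastSatisfying Q? Q0 (suc N) with Q? (suc N)
... | yes Q[1+N] = suc N , ≤-refl , Q[1+N] , λ 1+N<i i≤1+N → contradiction i≤1+N (<⇒≱ 1+N<i)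
... | no ¬Q[1+N] with lastSatisfying Q? Q0 N
...   | t , t≤N , Qt , after = t , m≤n⇒m≤1+n t≤N , Qt , after′
  where
  after′ : ∀ {i} → t < i → i ≤ suc N → ¬ _
  after′ t<i i≤1+N with m≤n⇒m<n∨m≡n i≤1+N
  ... | inj₁ i<1+N = after t<i (m<1+n⇒m≤n i<1+N)
  ... | inj₂ refl  = ¬Q[1+N]

crossing : ∀ (F G : ℕ → ℕ) N →
           (∀ {i j} → i ≤ j → j ≤ suc N → F i ≤ F j) →
           (∀ {i j} → i ≤ j → j ≤ N → G j ≤ G i) →
           F 0 < G 0 →
           ∃[ t ] t < suc N
             × (∀ i → i ≤ t → F i < G i)
             × (∀ i → t < i → i < suc N → G i ≤ F i)
             × F (suc N) ⊓ minUpTo (λ d → F d ⊔ G d) N ≡ F (suc t) ⊓ G t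
crossing F G N F-mono G-anti F0<G0 with lastSatisfying (λ i → F i <? G i) F0<G0 N
... | t , t≤N , Ft<Gt , after = t , s≤s t≤N , below , above , ≤-antisym min-max-≤ min-max-≥
  where
  below : ∀ i → i ≤ t → F i < G i
  below i i≤t = ≤-<-trans (F-mono i≤t (m≤n⇒m≤1+n t≤N)) (<-≤-trans Ft<Gt (G-anti i≤t t≤N))

  above : ∀ i → t < i → i < suc N → G i ≤ F i
  above i t<i i<1+N = ≮⇒≥ (after t<i (m<1+n⇒m≤n i<1+N))

  H : ℕ → ℕ
  H d = F d ⊔ G d

  ≤F[1+t] : F (suc N) ⊓ minUpTo H N ≤ F (suc t)
  ≤F[1+t] with m≤n⇒m<n∨m≡n t≤N
  ... | inj₁ t<N = ≤-trans (m⊓n≤n _ _)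
                     (≤-trans (minUpTo-≤ H t<N) (≤-reflexive (m≥n⇒m⊔n≡m (above (suc t) ≤-refl (s≤s t<N)))))
  ... | inj₂ refl = m⊓n≤m _ _

  ≤G[t] : F (suc N) ⊓ minUpTo H N ≤ G t
  ≤G[t] = ≤-trans (m⊓n≤n _ _) (≤-trans (minUpTo-≤ H t≤N) (≤-reflexive (m≤n⇒m⊔n≡n (<⇒≤ Ft<Gt))))

  ≤H : ∀ {d} → d ≤ N → F (suc t) ⊓ G t ≤ H d
  ≤H {d} d≤N with d ≤? t
  ... | yes d≤t = ≤-trans (m⊓n≤n _ _) (≤-trans (G-anti d≤t t≤N) (m≤n⊔m _ _))
  ... | no  d≰t = ≤-trans (m⊓n≤m _ _) (≤-trans (F-mono (≰⇒> d≰t) (m≤n⇒m≤1+n d≤N)) (m≤m⊔n _ _))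

  min-max-≤ : F (suc N) ⊓ minUpTo H N ≤ F (suc t) ⊓ G t
  min-max-≤ = ⊓-glb ≤F[1+t] ≤G[t]

  min-max-≥ : F (suc t) ⊓ G t ≤ F (suc N) ⊓ minUpTo H N
  min-max-≥ = ⊓-glb (≤-trans (m⊓n≤m _ _) (F-mono (s≤s t≤N) ≤-refl)) (minUpTo-glb H N ≤H)

-- Evacuation of a single chain

cum-≤ : ∀ ω κ a t → cum ω κ a t ≤ ω + a t
cum-≤ ω κ a zero    = m⊓n≤n _ _
cum-≤ ω κ a (suc t) = m⊓n≤n _ _

+-⊓-capped : ∀ ω {u v} C → u ⊓ C ≤ v → (ω + u) ⊓ (ω + C) ≤ ω + v
+-⊓-capped ω {u} C u⊓C≤v = subst (_≤ ω + _) (+-distribˡ-⊓ ω u C) (+-monoʳ-≤ ω u⊓C≤v)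

cum-capped : ∀ ω κ {a a′} C → (∀ t → a′ t ⊓ C ≤ a t) → ∀ t → cum ω κ a′ t ⊓ (ω + C) ≤ cum ω κ a t
cum-capped ω κ {a} {a′} C a′≤a zero =
  ⊓-glb (≤-trans (m⊓n≤m _ _) (m⊓n≤m _ _))
        (≤-trans (⊓-monoˡ-≤ (ω + C) (m⊓n≤n κ _)) (+-⊓-capped ω C (a′≤a 0)))
cum-capped ω κ {a} {a′} C a′≤a (suc t) =
  ⊓-glb (begin
           ((E′ + κ) ⊓ (ω + a′ (suc t))) ⊓ (ω + C) ≤⟨ ⊓-monoˡ-≤ (ω + C) (m⊓n≤m _ _) ⟩
           (E′ + κ) ⊓ (ω + C)                     ≤⟨ ⊓-monoʳ-≤ (E′ + κ) (m≤m+n (ω + C) κ) ⟩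
           (E′ + κ) ⊓ (ω + C + κ)                 ≡⟨ +-distribʳ-⊓ κ E′ (ω + C) ⟨
           E′ ⊓ (ω + C) + κ                       ≤⟨ +-monoˡ-≤ κ (cum-capped ω κ C a′≤a t) ⟩
           cum ω κ a t + κ                        ∎)
        (≤-trans (⊓-monoˡ-≤ (ω + C) (m⊓n≤n _ _)) (+-⊓-capped ω C (a′≤a (suc t))))
  where
  open ≤-Reasoning
  E′ = cum ω κ a′ t

if-⊓-mono : ∀ b {x y z} → x ⊓ z ≤ y → (if b then x else 0) ⊓ z ≤ (if b then y else 0)
if-⊓-mono true  x⊓z≤y = x⊓z≤y
if-⊓-mono false _     = z≤n

-- FIFO: the people of ys, being farther from the sink, only ever queue behind those of xs.
mutual
  Ent-++ : ∀ xs ys t → Ent (xs ++ ys) t ⊓ totW xs ≤ Ent xs t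
  Ent-++ []                ys t = m⊓n≤n _ _
  Ent-++ ((ω , κ , ℓ) ∷ r) ys t = cum-capped ω κ (totW r) (Arr-++ r ys) t

  Arr-++ : ∀ xs ys t → Arr (xs ++ ys) t ⊓ totW xs ≤ Arr xs t
  Arr-++ []                ys t = m⊓n≤n _ _
  Arr-++ ((ω , κ , ℓ) ∷ r) ys t = if-⊓-mono (ℓ ≤ᵇ t) (Ent-++ ((ω , κ , ℓ) ∷ r) ys (t ∸ ℓ))

Arr-∷-≤ : ∀ ω κ ℓ r t → Arr ((ω , κ , ℓ) ∷ r) t ≤ ω + Arr r (t ∸ ℓ)
Arr-∷-≤ ω κ ℓ r t with ℓ ≤ᵇ t
... | true  = cum-≤ ω κ (Arr r) (t ∸ ℓ)
... | false = z≤n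

totW-++ : ∀ xs ys → totW (xs ++ ys) ≡ totW xs + totW ys
totW-++ []                ys = refl
totW-++ ((ω , κ , ℓ) ∷ r) ys = trans (cong (ω +_) (totW-++ r ys)) (sym (+-assoc ω _ _))

sumLen-++ : ∀ xs ys → sumLen (xs ++ ys) ≡ sumLen xs + sumLen ys
sumLen-++ []                ys = refl
sumLen-++ ((ω , κ , ℓ) ∷ r) ys = trans (cong (ℓ +_) (sumLen-++ r ys)) (sym (+-assoc ℓ _ _))

totW-≤-++ : ∀ xs ys → totW xs ≤ totW (xs ++ ys)
totW-≤-++ xs ys = subst (totW xs ≤_) (sym (totW-++ xs ys)) (m≤m+n _ _)

bound-mono : ∀ xs ys → totW xs ≤ totW ys → length xs ≤ length ys → sumLen xs ≤ sumLen ys →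
             bound xs ≤ bound ys
bound-mono xs ys W≤ length≤ sumLen≤ = *-mono-≤ (+-monoˡ-≤ 1 W≤) (+-mono-≤ (+-monoˡ-≤ 1 length≤) sumLen≤)

bound-++ : ∀ xs ys → bound xs ≤ bound (xs ++ ys)
bound-++ xs ys = bound-mono xs (xs ++ ys) (totW-≤-++ xs ys)
  (subst (length xs ≤_) (sym (length-++ xs)) (m≤m+n _ _))
  (subst (sumLen xs ≤_) (sym (sumLen-++ xs ys)) (m≤m+n _ _))

bound-∷ : ∀ x r → bound r ≤ bound (x ∷ r)
bound-∷ (ω , κ , ℓ) r = bound-mono r ((ω , κ , ℓ) ∷ r) (m≤n+m _ ω) (n≤1+n _) (m≤n+m _ ℓ)

bound-pos : ∀ xs → 0 < bound xs
bound-pos xs = *-mono-≤ (m≤n+m 1 (totW xs)) (≤-trans (m≤n+m 1 (length xs)) (m≤m+n _ (sumLen xs)))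

arrTime-empty : ∀ xs → totW xs ≡ 0 → arrTime xs ≡ 0
arrTime-empty xs W≡0 = if-T (≡⇒≡ᵇ (totW xs) 0 W≡0)

arrTime-nonempty : ∀ xs → 0 < totW xs → arrTime xs ≡ firstAt (λ t → totW xs ≤ᵇ Arr xs t) (bound xs)
arrTime-nonempty xs W>0 = if-¬T (<⇒≢ W>0 ∘ sym ∘ ≡ᵇ⇒≡ (totW xs) 0)

stubT-empty : ∀ xs d → totW xs ≡ 0 → stubT xs d ≡ 0
stubT-empty xs d W≡0 = if-T (≡⇒≡ᵇ (totW xs) 0 W≡0)

stubT-nonempty : ∀ xs d → 0 < totW xs → stubT xs d ≡ 2 * entTime xs + d
stubT-nonempty xs d W>0 = if-¬T (<⇒≢ W>0 ∘ sym ∘ ≡ᵇ⇒≡ (totW xs) 0)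

arrTime-mono : ∀ xs ys → totW xs ≤ totW ys → bound xs ≤ bound ys →
               (∀ t → totW ys ≤ Arr ys t → ∃[ s ] s ≤ t × totW xs ≤ Arr xs s) →
               arrTime xs ≤ arrTime ys
arrTime-mono xs ys W≤ B≤ reach with totW xs ≟ 0
... | yes W≡0 = ≤-trans (≤-reflexive (arrTime-empty xs W≡0)) z≤n
... | no  W≢0 = subst₂ _≤_ (sym (arrTime-nonempty xs W>0)) (sym (arrTime-nonempty ys (<-≤-trans W>0 W≤)))
                  (firstAt-≤ᵇ-mono (Arr xs) (Arr ys) B≤ reach)
  where W>0 = n≢0⇒n>0 W≢0

stubT-mono : ∀ xs ys d → totW xs ≤ totW ys → entTime xs ≤ entTime ys → stubT xs d ≤ stubT ys d
stubT-mono xs ys d W≤ E≤ with totW xs ≟ 0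
... | yes W≡0 = ≤-trans (≤-reflexive (stubT-empty xs d W≡0)) z≤n
... | no  W≢0 = subst₂ _≤_ (sym (stubT-nonempty xs d W>0)) (sym (stubT-nonempty ys d (<-≤-trans W>0 W≤)))
                  (+-monoˡ-≤ d (*-monoʳ-≤ 2 E≤))
  where W>0 = n≢0⇒n>0 W≢0

capped⇒≤ : ∀ {W A B} → W ≤ A → A ⊓ W ≤ B → W ≤ B
capped⇒≤ W≤A A⊓W≤B = ≤-trans (⊓-glb W≤A ≤-refl) A⊓W≤B

arrTime-++ : ∀ xs ys → arrTime xs ≤ arrTime (xs ++ ys)
arrTime-++ xs ys = arrTime-mono xs (xs ++ ys) (totW-≤-++ xs ys) (bound-++ xs ys) reach
  where
  reach : ∀ t → totW (xs ++ ys) ≤ Arr (xs ++ ys) t → ∃[ s ] s ≤ t × totW xs ≤ Arr xs s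
  reach t full = t , ≤-refl , capped⇒≤ (≤-trans (totW-≤-++ xs ys) full) (Arr-++ xs ys t)

entTime-++ : ∀ xs ys → entTime xs ≤ entTime (xs ++ ys)
entTime-++ xs ys = firstAt-≤ᵇ-mono (Ent xs) (Ent (xs ++ ys)) (bound-++ xs ys) reach
  where
  reach : ∀ t → totW (xs ++ ys) ≤ Ent (xs ++ ys) t → ∃[ s ] s ≤ t × totW xs ≤ Ent xs s
  reach t full = t , ≤-refl , capped⇒≤ (≤-trans (totW-≤-++ xs ys) full) (Ent-++ xs ys t)

stubT-++ : ∀ xs ys d → stubT xs d ≤ stubT (xs ++ ys) d
stubT-++ xs ys d = stubT-mono xs (xs ++ ys) d (totW-≤-++ xs ys) (entTime-++ xs ys)

arrTime-∷ : ∀ x r → arrTime r ≤ arrTime (x ∷ r)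
arrTime-∷ (ω , κ , ℓ) r = arrTime-mono r ((ω , κ , ℓ) ∷ r) (m≤n+m _ ω) (bound-∷ (ω , κ , ℓ) r) reach
  where
  reach : ∀ t → ω + totW r ≤ Arr ((ω , κ , ℓ) ∷ r) t → ∃[ s ] s ≤ t × totW r ≤ Arr r s
  reach t full = t ∸ ℓ , m∸n≤m t ℓ , +-cancelˡ-≤ ω _ _ (≤-trans full (Arr-∷-≤ ω κ ℓ r t))

arrTime≤entTime-∷ : ∀ x r → arrTime r ≤ entTime (x ∷ r)
arrTime≤entTime-∷ (ω , κ , ℓ) r with totW r ≟ 0
... | yes W≡0 = ≤-trans (≤-reflexive (arrTime-empty r W≡0)) z≤n
... | no  W≢0 = ≤-trans (≤-reflexive (arrTime-nonempty r (n≢0⇒n>0 W≢0)))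
                  (firstAt-≤ᵇ-mono (Arr r) (Ent ((ω , κ , ℓ) ∷ r)) (bound-∷ (ω , κ , ℓ) r) reach)
  where
  reach : ∀ t → ω + totW r ≤ Ent ((ω , κ , ℓ) ∷ r) t → ∃[ s ] s ≤ t × totW r ≤ Arr r s
  reach t full = t , ≤-refl , +-cancelˡ-≤ ω _ _ (≤-trans full (cum-≤ ω κ (Arr r) t))

arrTime≤stubT-∷ : ∀ x r d → 2 * arrTime r ≤ stubT (x ∷ r) d
arrTime≤stubT-∷ (ω , κ , ℓ) r d with totW r ≟ 0
... | yes W≡0 = ≤-trans (≤-reflexive (cong (2 *_) (arrTime-empty r W≡0))) z≤n
... | no  W≢0 = ≤-trans (≤-trans (*-monoʳ-≤ 2 (arrTime≤entTime-∷ (ω , κ , ℓ) r)) (m≤m+n _ d))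
                  (≤-reflexive (sym (stubT-nonempty ((ω , κ , ℓ) ∷ r) d (<-≤-trans (n≢0⇒n>0 W≢0) (m≤n+m _ ω)))))

-- Nobody crosses an edge of positive length at time 0.
arrTime-pos : ∀ ω κ ℓ r → 1 ≤ ℓ → 0 < ω + totW r → 0 < arrTime ((ω , κ , ℓ) ∷ r)
arrTime-pos ω κ (suc ℓ) r _ W>0 =
  subst (0 <_) (sym (arrTime-nonempty ((ω , κ , suc ℓ) ∷ r) W>0))
    (firstAt-pos _ (bound-pos ((ω , κ , suc ℓ) ∷ r)) (not-full W>0))
  where
  not-full : ∀ {W} → 0 < W → (W ≤ᵇ 0) ≡ false
  not-full z<s = refl

stubT-≥ : ∀ xs d → 0 < totW xs → d ≤ stubT xs d
stubT-≥ xs d W>0 = subst (d ≤_) (sym (stubT-nonempty xs d W>0)) (m≤n+m d _)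

-- Sinks of a subpath and Θ¹

module _ {n : ℕ} (P : DynPath n) where
  open DynPath P

  fromLeft-suc : ∀ a c → fromLeft P a (suc c) ≡ fromLeft P (suc a) c ++ [ rNode P a ]
  fromLeft-suc a zero    = cong (λ i → [ rNode P i ]) (+-identityʳ a)
  fromLeft-suc a (suc c) = cong₂ _∷_ (cong (rNode P) (+-suc a c)) (fromLeft-suc a c)

  fromRight-suc : ∀ lo c → fromRight P lo (suc c) ≡ fromRight P lo c ++ [ lNode P (lo + c) ]
  fromRight-suc lo zero    = cong (λ i → [ lNode P i ]) (sym (+-identityʳ lo))
  fromRight-suc lo (suc c) rewrite +-suc lo c = cong (lNode P lo ∷_) (fromRight-suc (suc lo) c)

  arrTime-fromLeft-suc : ∀ a c → arrTime (fromLeft P (suc a) c) ≤ arrTime (fromLeft P a (suc c))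
  arrTime-fromLeft-suc a c = subst (λ zs → arrTime (fromLeft P (suc a) c) ≤ arrTime zs)
    (sym (fromLeft-suc a c)) (arrTime-++ (fromLeft P (suc a) c) [ rNode P a ])

  stubT-fromLeft-suc : ∀ a c d → stubT (fromLeft P (suc a) c) d ≤ stubT (fromLeft P a (suc c)) d
  stubT-fromLeft-suc a c d = subst (λ zs → stubT (fromLeft P (suc a) c) d ≤ stubT zs d)
    (sym (fromLeft-suc a c)) (stubT-++ (fromLeft P (suc a) c) [ rNode P a ] d)

  arrTime-fromRight-suc : ∀ lo c → arrTime (fromRight P lo c) ≤ arrTime (fromRight P lo (suc c))
  arrTime-fromRight-suc lo c = subst (λ zs → arrTime (fromRight P lo c) ≤ arrTime zs)
    (sym (fromRight-suc lo c)) (arrTime-++ (fromRight P lo c) [ lNode P (lo + c) ])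

  stubT-fromRight-suc : ∀ lo c d → stubT (fromRight P lo c) d ≤ stubT (fromRight P lo (suc c)) d
  stubT-fromRight-suc lo c d = subst (λ zs → stubT (fromRight P lo c) d ≤ stubT zs d)
    (sym (fromRight-suc lo c)) (stubT-++ (fromRight P lo c) [ lNode P (lo + c) ] d)

  evac-extendʳ : ∀ {a b j} δ → j ≤ b → evac P a b j δ ≤ evac P a (suc b) j δ
  evac-extendʳ {a} {b} {j} zero j≤b rewrite 1+n∸m≡1+[n∸m] j≤b =
    *-monoʳ-≤ 2 (⊔-monoʳ-≤ (arrTime (fromLeft P a (j ∸ a))) (arrTime-fromRight-suc (suc j) (b ∸ j)))
  evac-extendʳ {a} {b} {j} (suc δ) j≤b rewrite 1+n∸m≡1+[n∸m] j≤b =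
    ⊔-monoʳ-≤ (stubT (fromLeft P a (suc (j ∸ a))) (suc δ)) (stubT-fromRight-suc (suc j) (b ∸ j) _)

  evac-dropˡ : ∀ {a b j} δ → a < j → evac P (suc a) b j δ ≤ evac P a b j δ
  evac-dropˡ {a} {b} {j} zero a<j rewrite n∸m≡1+[n∸1+m] a<j =
    *-monoʳ-≤ 2 (⊔-monoˡ-≤ (arrTime (fromRight P (suc j) (b ∸ j))) (arrTime-fromLeft-suc a (j ∸ suc a)))
  evac-dropˡ {a} {b} {j} (suc δ) a<j rewrite n∸m≡1+[n∸1+m] a<j =
    ⊔-monoˡ-≤ (stubT (fromRight P (suc j) (b ∸ j)) (2 * len (suc j) ∸ suc δ))
      (stubT-fromLeft-suc a (suc (j ∸ suc a)) (suc δ))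

  evac-atʳ : ∀ a b → evac P a b b 0 ≡ 2 * arrTime (fromLeft P a (b ∸ a))
  evac-atʳ a b rewrite n∸n≡0 b = cong (2 *_) (⊔-identityʳ (arrTime (fromLeft P a (b ∸ a))))

  evac-atˡ : ∀ a b → evac P a b a 0 ≡ 2 * arrTime (fromRight P (suc a) (b ∸ a))
  evac-atˡ a b rewrite n∸n≡0 a = refl

  evac-atʳ-≤ : ∀ {a b} δ → evac P a b b 0 ≤ evac P a (suc b) b δ
  evac-atʳ-≤ {a} {b} zero rewrite evac-atʳ a b =
    *-monoʳ-≤ 2 (m≤m⊔n (arrTime (fromLeft P a (b ∸ a))) (arrTime (fromRight P (suc b) (suc b ∸ b))))
  evac-atʳ-≤ {a} {b} (suc δ) rewrite evac-atʳ a b =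
    ≤-trans (arrTime≤stubT-∷ (rNode P (a + (b ∸ a))) (fromLeft P a (b ∸ a)) (suc δ))
      (m≤m⊔n _ (stubT (fromRight P (suc b) (suc b ∸ b)) (2 * len (suc b) ∸ suc δ)))

  evac-atʳ-≤-suc : ∀ {a b} → a ≤ b → evac P a b b 0 ≤ evac P a (suc b) (suc b) 0
  evac-atʳ-≤-suc {a} {b} a≤b rewrite evac-atʳ a b | evac-atʳ a (suc b) | 1+n∸m≡1+[n∸m] a≤b =
    *-monoʳ-≤ 2 (arrTime-∷ (rNode P (a + (b ∸ a))) (fromLeft P a (b ∸ a)))

  evac-atˡ-≤ : ∀ {a b} δ → a < b → evac P (suc a) b (suc a) 0 ≤ evac P a b a δ
  evac-atˡ-≤ {a} {b} zero a<b rewrite evac-atˡ (suc a) b | evac-atˡ a b | n∸m≡1+[n∸1+m] a<b =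
    *-monoʳ-≤ 2 (arrTime-∷ (lNode P (suc a)) (fromRight P (suc (suc a)) (b ∸ suc a)))
  evac-atˡ-≤ {a} {b} (suc δ) a<b rewrite evac-atˡ (suc a) b | n∸m≡1+[n∸1+m] a<b =
    ≤-trans (arrTime≤stubT-∷ (lNode P (suc a)) (fromRight P (suc (suc a)) (b ∸ suc a)) _)
      (m≤n⊔m (stubT (fromLeft P a (suc (a ∸ a))) (suc δ)) _)

  IsSink : ℕ → ℕ → ℕ → ℕ → Set
  IsSink a b j δ = a ≤ j × j ≤ b × (j < b → δ ≤ 2 * len (suc j) ∸ 1) × (b ≤ j → δ ≡ 0)

  vertexSink : ∀ {a b j} → a ≤ j → j ≤ b → IsSink a b j 0
  vertexSink a≤j j≤b = a≤j , j≤b , (λ _ → z≤n) , (λ _ → refl)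

  -- A copy of the local function of Θ¹, so that Θ¹ P a b unfolds to
  -- minUpTo (λ d → sinkMin a b (a + d)) (b ∸ a).
  sinkMin : ℕ → ℕ → ℕ → ℕ
  sinkMin a b j = if j <ᵇ b then minUpTo (evac P a b j) (2 * len (suc j) ∸ 1) else evac P a b j 0

  Θ¹-≤-evac : ∀ {a b j δ} → IsSink a b j δ → Θ¹ P a b ≤ evac P a b j δ
  Θ¹-≤-evac {a} {b} {j} {δ} (a≤j , j≤b , inEdge , atEnd) = begin
    Θ¹ P a b                  ≤⟨ minUpTo-≤ (λ d → sinkMin a b (a + d)) (∸-monoˡ-≤ a j≤b) ⟩
    sinkMin a b (a + (j ∸ a)) ≡⟨ cong (sinkMin a b) (m+[n∸m]≡n a≤j) ⟩
    sinkMin a b j             ≤⟨ sinkMin-≤ ⟩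
    evac P a b j δ            ∎
    where
    open ≤-Reasoning
    sinkMin-≤ : sinkMin a b j ≤ evac P a b j δ
    sinkMin-≤ with j <? b
    ... | yes j<b = ≤-trans (≤-reflexive (if-T (<⇒<ᵇ j<b))) (minUpTo-≤ (evac P a b j) (inEdge j<b))
    ... | no  j≮b rewrite atEnd (≮⇒≥ j≮b) = ≤-reflexive (if-¬T (j≮b ∘ <ᵇ⇒< j b))

  Θ¹-attained : ∀ {a b} → a ≤ b → ∃[ j ] ∃[ δ ] IsSink a b j δ × Θ¹ P a b ≡ evac P a b j δ
  Θ¹-attained {a} {b} a≤b with minUpTo-attained (λ d → sinkMin a b (a + d)) (b ∸ a)
  ... | d , d≤b∸a , Θ¹≡ with a + d <? b
  ...   | no j≮b = a + d , 0 , vertexSink (m≤m+n a d) j≤b , trans Θ¹≡ (if-¬T (j≮b ∘ <ᵇ⇒< (a + d) b))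
    where j≤b = ≤-trans (+-monoʳ-≤ a d≤b∸a) (≤-reflexive (m+[n∸m]≡n a≤b))
  ...   | yes j<b with minUpTo-attained (evac P a b (a + d)) (2 * len (suc (a + d)) ∸ 1)
  ...     | δ , δ≤ , min≡ =
    a + d , δ , (m≤m+n a d , <⇒≤ j<b , (λ _ → δ≤) , λ b≤j → contradiction b≤j (<⇒≱ j<b)) ,
    trans Θ¹≡ (trans (if-T (<⇒<ᵇ j<b)) min≡)

  Θ¹-≤-by-sinks : ∀ {a b a′ b′} → a ≤ b →
                  (∀ {j δ} → IsSink a b j δ →
                     ∃[ j′ ] ∃[ δ′ ] IsSink a′ b′ j′ δ′ × evac P a′ b′ j′ δ′ ≤ evac P a b j δ) →
                  Θ¹ P a′ b′ ≤ Θ¹ P a b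
  Θ¹-≤-by-sinks a≤b better with Θ¹-attained a≤b
  ... | j , δ , sink , Θ¹≡ with better sink
  ...   | j′ , δ′ , sink′ , ≤evac = ≤-trans (Θ¹-≤-evac sink′) (≤-trans ≤evac (≤-reflexive (sym Θ¹≡)))

  Θ¹-extendʳ : ∀ {a b} → a ≤ b → Θ¹ P a b ≤ Θ¹ P a (suc b)
  Θ¹-extendʳ {a} {b} a≤b = Θ¹-≤-by-sinks (m≤n⇒m≤1+n a≤b) restrict
    where
    restrict : ∀ {j δ} → IsSink a (suc b) j δ →
               ∃[ j′ ] ∃[ δ′ ] IsSink a b j′ δ′ × evac P a b j′ δ′ ≤ evac P a (suc b) j δ
    restrict {j} {δ} (a≤j , j≤1+b , inEdge , atEnd) with <-cmp j b
    ... | tri< j<b _ _ =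
      j , δ , (a≤j , <⇒≤ j<b , (λ _ → inEdge (m<n⇒m<1+n j<b)) , (λ b≤j → contradiction b≤j (<⇒≱ j<b))) ,
      evac-extendʳ {a} δ (<⇒≤ j<b)
    ... | tri≈ _ refl _ = b , 0 , vertexSink a≤b ≤-refl , evac-atʳ-≤ {a} δ
    ... | tri> _ _ b<j with ≤-antisym j≤1+b b<j
    ...   | refl rewrite atEnd ≤-refl = b , 0 , vertexSink a≤b ≤-refl , evac-atʳ-≤-suc a≤b

  Θ¹-dropˡ : ∀ {a b} → a < b → Θ¹ P (suc a) b ≤ Θ¹ P a b
  Θ¹-dropˡ {a} {b} a<b = Θ¹-≤-by-sinks (<⇒≤ a<b) restrict
    where
    restrict : ∀ {j δ} → IsSink a b j δ →
               ∃[ j′ ] ∃[ δ′ ] IsSink (suc a) b j′ δ′ × evac P (suc a) b j′ δ′ ≤ evac P a b j δ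
    restrict {j} {δ} (a≤j , sink) with m≤n⇒m<n∨m≡n a≤j
    ... | inj₁ a<j  = j , δ , (a<j , sink) , evac-dropˡ {b = b} δ a<j
    ... | inj₂ refl = suc a , 0 , vertexSink ≤-refl a<b , evac-atˡ-≤ δ a<b

  Θ¹-single : ∀ a → Θ¹ P a a ≡ 0
  Θ¹-single a = n≤0⇒n≡0 (begin
    Θ¹ P a a                              ≤⟨ Θ¹-≤-evac (vertexSink {a} ≤-refl ≤-refl) ⟩
    evac P a a a 0                        ≡⟨ evac-atʳ a a ⟩
    2 * arrTime (fromLeft P a (a ∸ a))    ≡⟨ cong (λ c → 2 * arrTime (fromLeft P a c)) (n∸n≡0 a) ⟩
    0                                     ∎)
    where open ≤-Reasoning

  -- Positive weights force positive evacuation times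

  wt≤totW-fromLeft : ∀ a c {i} → a ≤ i → i < a + c → wt i ≤ totW (fromLeft P a c)
  wt≤totW-fromLeft a zero    a≤i i<a+0 = contradiction i<a+0 (≤⇒≮+0 a≤i)
  wt≤totW-fromLeft a (suc c) {i} a≤i i<a+1+c with i ≟ a + c
  ... | yes refl = m≤m+n _ _
  ... | no  i≢a+c = ≤-trans (wt≤totW-fromLeft a c a≤i (≤∧≢⇒< i≤a+c i≢a+c)) (m≤n+m _ _)
    where i≤a+c = ≤-pred (subst (i <_) (+-suc a c) i<a+1+c)

  wt≤totW-fromRight : ∀ lo c {i} → lo ≤ i → i < lo + c → wt i ≤ totW (fromRight P lo c)
  wt≤totW-fromRight lo zero    lo≤i i<lo+0 = contradiction i<lo+0 (≤⇒≮+0 lo≤i)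
  wt≤totW-fromRight lo (suc c) {i} lo≤i i<lo+1+c with lo ≟ i
  ... | yes refl = m≤m+n _ _
  ... | no  lo≢i = ≤-trans (wt≤totW-fromRight (suc lo) c (≤∧≢⇒< lo≤i lo≢i) i<1+lo+c) (m≤n+m _ _)
    where i<1+lo+c = subst (i <_) (+-suc lo c) i<lo+1+c

  arrTime-fromLeft-pos : ∀ a c {i} → a ≤ i → i < a + c → a + c ≤ n → 0 < wt i → 0 < arrTime (fromLeft P a c)
  arrTime-fromLeft-pos a zero    a≤i i<a+0 _ _ = contradiction i<a+0 (≤⇒≮+0 a≤i)
  arrTime-fromLeft-pos a (suc c) a≤i i<a+1+c a+1+c≤n wi>0 =
    arrTime-pos _ _ _ (fromLeft P a c) (len-pos (suc (a + c)) (s≤s z≤n) (subst (_≤ n) (+-suc a c) a+1+c≤n))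
      (<-≤-trans wi>0 (wt≤totW-fromLeft a (suc c) a≤i i<a+1+c))

  arrTime-fromRight-pos : ∀ lo c {i} → lo ≤ i → i < lo + c → 1 ≤ lo → lo ≤ n → 0 < wt i →
                          0 < arrTime (fromRight P lo c)
  arrTime-fromRight-pos lo zero    lo≤i i<lo+0 _ _ _ = contradiction i<lo+0 (≤⇒≮+0 lo≤i)
  arrTime-fromRight-pos lo (suc c) lo≤i i<lo+1+c 1≤lo lo≤n wi>0 =
    arrTime-pos _ _ _ (fromRight P (suc lo) c) (len-pos lo 1≤lo lo≤n)
      (<-≤-trans wi>0 (wt≤totW-fromRight lo (suc c) lo≤i i<lo+1+c))

  evac-vertex-pos : ∀ {a b j i} → a ≤ j → j ≤ b → b ≤ n → a ≤ i → i ≤ b → i ≢ j → 0 < wt i →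
                    0 < evac P a b j 0
  evac-vertex-pos {a} {b} {j} {i} a≤j j≤b b≤n a≤i i≤b i≢j wi>0 =
    ≤-trans (side (<-cmp i j)) (m≤m+n (X ⊔ Y) _)
    where
    X = arrTime (fromLeft P a (j ∸ a))
    Y = arrTime (fromRight P (suc j) (b ∸ j))
    side : Tri (i < j) (i ≡ j) (j < i) → 0 < X ⊔ Y
    side (tri< i<j _ _) = ≤-trans
      (arrTime-fromLeft-pos a (j ∸ a) a≤i (subst (i <_) (sym (m+[n∸m]≡n a≤j)) i<j)
         (≤-trans (≤-reflexive (m+[n∸m]≡n a≤j)) (≤-trans j≤b b≤n)) wi>0)
      (m≤m⊔n X Y)
    side (tri≈ _ i≡j _) = contradiction i≡j i≢j
    side (tri> _ _ j<i) = ≤-trans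
      (arrTime-fromRight-pos (suc j) (b ∸ j) j<i (s≤s (≤-trans i≤b (≤-reflexive (sym (m+[n∸m]≡n j≤b)))))
         (s≤s z≤n) (≤-trans j<i (≤-trans i≤b b≤n)) wi>0)
      (m≤n⊔m X Y)

  evac-edge-pos : ∀ {a b j δ i} → a ≤ j → j < b → suc δ ≤ 2 * len (suc j) ∸ 1 → a ≤ i → i ≤ b → 0 < wt i →
                  0 < evac P a b j (suc δ)
  evac-edge-pos {a} {b} {j} {δ} {i} a≤j j<b δ-range a≤i i≤b wi>0 with i ≤? j
  ... | yes i≤j = ≤-trans (s≤s z≤n) (≤-trans (stubT-≥ L (suc δ) L>0) (m≤m⊔n _ _))
    where
    L = fromLeft P a (suc (j ∸ a))
    L>0 : 0 < totW L
    L>0 = <-≤-trans wi>0 (wt≤totW-fromLeft a (suc (j ∸ a)) a≤i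
            (subst (i <_) (sym (trans (+-suc a (j ∸ a)) (cong suc (m+[n∸m]≡n a≤j)))) (s≤s i≤j)))
  ... | no  i≰j = ≤-trans (m<n⇒0<n∸m (below-edge-end {k = 2 * len (suc j)} δ-range))
                    (≤-trans (stubT-≥ R _ R>0) (m≤n⊔m _ _))
    where
    R = fromRight P (suc j) (b ∸ j)
    R>0 : 0 < totW R
    R>0 = <-≤-trans wi>0 (wt≤totW-fromRight (suc j) (b ∸ j) (≰⇒> i≰j)
            (s≤s (≤-trans i≤b (≤-reflexive (sym (m+[n∸m]≡n (<⇒≤ j<b)))))))
    below-edge-end : ∀ {m k} → suc m ≤ k ∸ 1 → suc m < k
    below-edge-end {k = suc k} 1+m≤k = s≤s 1+m≤k

  evac-pos : ∀ {a b j δ i} → b ≤ n → IsSink a b j δ → a ≤ i → i ≤ b → i ≢ j → 0 < wt i →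
             0 < evac P a b j δ
  evac-pos {δ = zero}  b≤n (a≤j , j≤b , _) = evac-vertex-pos a≤j j≤b b≤n
  evac-pos {b = b} {j} {δ = suc δ} b≤n (a≤j , j≤b , inEdge , atEnd) a≤i i≤b _ with j <? b
  ... | yes j<b = evac-edge-pos a≤j j<b (inEdge j<b) a≤i i≤b
  ... | no  j≮b = contradiction (atEnd (≮⇒≥ j≮b)) (λ ())

  posCountOn : ℕ → ℕ → ℕ
  posCountOn a b = countPos (λ e → wt (a + e)) (b ∸ a)

  posCountOn-split : ∀ {a c b} → a ≤ c → c < b → posCountOn a b ≡ posCountOn a c + posCountOn (suc c) b
  posCountOn-split {a} {c} {b} a≤c c<b = begin
    countPos g (b ∸ a)                                ≡⟨ cong (countPos g) b∸a≡ ⟩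
    countPos g (suc (r + d))                          ≡⟨ countPos-split g d r ⟩
    countPos g d + countPos (λ e → g (suc (e + d))) r ≡⟨ cong (countPos g d +_) (countPos-cong r (cong wt ∘ shift)) ⟩
    countPos g d + posCountOn (suc c) b               ∎
    where
    open ≡-Reasoning
    g : ℕ → ℕ
    g e = wt (a + e)
    r = b ∸ suc c
    d = c ∸ a
    b∸a≡ : b ∸ a ≡ suc (r + d)
    b∸a≡ = begin
      b ∸ a           ≡⟨ cong (_∸ a) (m+[n∸m]≡n c<b) ⟨
      suc c + r ∸ a   ≡⟨ 1+n∸m≡1+[n∸m] (≤-trans a≤c (m≤m+n c r)) ⟩
      suc (c + r ∸ a) ≡⟨ cong (λ x → suc (x ∸ a)) (+-comm c r) ⟩
      suc (r + c ∸ a) ≡⟨ cong suc (+-∸-assoc r a≤c) ⟩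
      suc (r + d)     ∎
    shift : ∀ e → a + suc (e + d) ≡ suc c + e
    shift e = begin
      a + suc (e + d)   ≡⟨ +-suc a (e + d) ⟩
      suc (a + (e + d)) ≡⟨ cong (λ x → suc (a + x)) (+-comm e d) ⟩
      suc (a + (d + e)) ≡⟨ cong suc (+-assoc a d e) ⟨
      suc (a + d + e)   ≡⟨ cong (λ x → suc (x + e)) (m+[n∸m]≡n a≤c) ⟩
      suc c + e         ∎

  posCountOn-single : ∀ a → posCountOn a a ≤ 1
  posCountOn-single a = subst (λ m → countPos (λ e → wt (a + e)) m ≤ 1) (sym (n∸n≡0 a)) (isPos≤1 (wt (a + 0)))

  posCountOn-after : ∀ {a c b k} → a ≤ c → c < b → suc k ≤ posCountOn a b → posCountOn a c ≤ 1 →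
                     k ≤ posCountOn (suc c) b
  posCountOn-after {a} {c} {b} a≤c c<b 1+k≤ ≤1 =
    ≤-pred (≤-trans (subst (_ ≤_) (posCountOn-split a≤c c<b) 1+k≤) (+-monoˡ-≤ (posCountOn (suc c) b) ≤1))

  posCountOn-≥2 : ∀ {a b j} → 2 ≤ posCountOn a b → a ≤ j → j ≤ b → ∃[ i ] a ≤ i × i ≤ b × i ≢ j × 0 < wt i
  posCountOn-≥2 {a} {b} {j} 2≤ a≤j j≤b with countPos-≥2 (λ e → wt (a + e)) (b ∸ a) 2≤ (j ∸ a)
  ... | d , d≤b∸a , d≢j∸a , wt>0 =
    a + d , m≤m+n a d , ≤-trans (+-monoʳ-≤ a d≤b∸a) (≤-reflexive (m+[n∸m]≡n (≤-trans a≤j j≤b))) ,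
    (λ a+d≡j → d≢j∸a (trans (sym (m+n∸m≡n a d)) (cong (_∸ a) a+d≡j))) , wt>0

  Θ¹-pos : ∀ {a b} → a ≤ b → b ≤ n → 2 ≤ posCountOn a b → 0 < Θ¹ P a b
  Θ¹-pos a≤b b≤n 2≤ with Θ¹-attained a≤b
  ... | j , δ , sink@(a≤j , j≤b , _) , Θ¹≡ with posCountOn-≥2 2≤ a≤j j≤b
  ...   | i , a≤i , i≤b , i≢j , wi>0 = subst (0 <_) (sym Θ¹≡) (evac-pos b≤n sink a≤i i≤b i≢j wi>0)

  -- Partitions into several parts

  cutAt : ℕ → ℕ → ℕ → ℕ → ℕ
  cutAt m a b d = Θ¹ P a (a + d) ⊔ Θ P (suc m) (suc (a + d)) b

  Θ-unfold-< : ∀ m {a b} → a < b → Θ P (suc (suc m)) a b ≡ Θ¹ P a b ⊓ minUpTo (cutAt m a b) (b ∸ suc a)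
  Θ-unfold-< m a<b = if-T (<⇒<ᵇ a<b)

  Θ-unfold-≥ : ∀ m {a b} → b ≤ a → Θ P (suc (suc m)) a b ≡ Θ¹ P a b
  Θ-unfold-≥ m {a} {b} b≤a = if-¬T (λ a<ᵇb → <⇒≱ (<ᵇ⇒< a b a<ᵇb) b≤a)

  Θ≤Θ¹ : ∀ m {a b} → Θ P m a b ≤ Θ¹ P a b
  Θ≤Θ¹ zero          = ≤-refl
  Θ≤Θ¹ (suc zero)    = ≤-refl
  Θ≤Θ¹ (suc (suc m)) {a} {b} with a <? b
  ... | yes a<b = ≤-trans (≤-reflexive (Θ-unfold-< m a<b)) (m⊓n≤m _ _)
  ... | no  a≮b = ≤-reflexive (Θ-unfold-≥ m (≮⇒≥ a≮b))

  Θ-suc-≤ : ∀ m {a b} → Θ P (suc (suc m)) a b ≤ Θ P (suc m) a b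
  Θ-suc-≤ zero {a} {b} = Θ≤Θ¹ 2 {a} {b}
  Θ-suc-≤ (suc m) {a} {b} with a <? b
  ... | no  a≮b = ≤-reflexive (trans (Θ-unfold-≥ (suc m) (≮⇒≥ a≮b)) (sym (Θ-unfold-≥ m (≮⇒≥ a≮b))))
  ... | yes a<b = begin
    Θ P (3 + m) a b                                   ≡⟨ Θ-unfold-< (suc m) a<b ⟩
    Θ¹ P a b ⊓ minUpTo (cutAt (suc m) a b) (b ∸ suc a) ≤⟨ ⊓-monoʳ-≤ (Θ¹ P a b) (minUpTo-mono (b ∸ suc a) cut≤) ⟩
    Θ¹ P a b ⊓ minUpTo (cutAt m a b) (b ∸ suc a)       ≡⟨ Θ-unfold-< m a<b ⟨
    Θ P (2 + m) a b                                   ∎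
    where
    open ≤-Reasoning
    cut≤ : ∀ {d} → d ≤ b ∸ suc a → cutAt (suc m) a b d ≤ cutAt m a b d
    cut≤ {d} _ = ⊔-monoʳ-≤ (Θ¹ P a (a + d)) (Θ-suc-≤ m)

  Θ-dropˡ : ∀ m {a b} → a < b → Θ P (suc m) (suc a) b ≤ Θ P (suc m) a b
  Θ-dropˡ zero    a<b = Θ¹-dropˡ a<b
  Θ-dropˡ (suc m) {a} {b} a<b = subst (Θ P (2 + m) (suc a) b ≤_) (sym (Θ-unfold-< m a<b))
    (⊓-glb (≤-trans (Θ≤Θ¹ (2 + m) {suc a} {b}) (Θ¹-dropˡ a<b)) (minUpTo-glb (cutAt m a b) (b ∸ suc a) ≤cut))
    where
    open ≤-Reasoning
    ≤cut : ∀ {d} → d ≤ b ∸ suc a → Θ P (2 + m) (suc a) b ≤ cutAt m a b d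
    ≤cut {zero} _ = begin
      Θ P (2 + m) (suc a) b            ≤⟨ Θ-suc-≤ m ⟩
      Θ P (suc m) (suc a) b            ≤⟨ m≤n⊔m (Θ¹ P a a) _ ⟩
      Θ¹ P a a ⊔ Θ P (suc m) (suc a) b ≡⟨ cong (λ x → Θ¹ P a x ⊔ Θ P (suc m) (suc x) b) (+-identityʳ a) ⟨
      cutAt m a b 0                    ∎
    ≤cut {suc d} 1+d≤b∸1+a = begin
      Θ P (2 + m) (suc a) b                                         ≡⟨ Θ-unfold-< m 1+a<b ⟩
      Θ¹ P (suc a) b ⊓ minUpTo (cutAt m (suc a) b) (b ∸ suc (suc a)) ≤⟨ m⊓n≤n _ _ ⟩
      minUpTo (cutAt m (suc a) b) (b ∸ suc (suc a))                 ≤⟨ minUpTo-≤ (cutAt m (suc a) b) d≤b∸2+a ⟩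
      Θ¹ P (suc a) (suc a + d) ⊔ Θ P (suc m) (suc (suc a + d)) b
        ≤⟨ ⊔-monoˡ-≤ _ (Θ¹-dropˡ (s≤s (m≤m+n a d))) ⟩
      Θ¹ P a (suc a + d) ⊔ Θ P (suc m) (suc (suc a + d)) b
        ≡⟨ cong (λ x → Θ¹ P a x ⊔ Θ P (suc m) (suc x) b) (+-suc a d) ⟨
      cutAt m a b (suc d) ∎
      where
      1+a<b : suc a < b
      1+a<b = m∸n≢0⇒n<m (m<n⇒n≢0 (≤-trans (s≤s z≤n) 1+d≤b∸1+a))
      d≤b∸2+a : d ≤ b ∸ suc (suc a)
      d≤b∸2+a = ≤-pred (subst (suc d ≤_) (n∸m≡1+[n∸1+m] 1+a<b) 1+d≤b∸1+a)

  Θ-pos : ∀ m {a b} → a ≤ b → b ≤ n → suc (suc m) ≤ posCountOn a b → 0 < Θ P (suc m) a b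
  Θ-pos zero    a≤b b≤n 2≤ = Θ¹-pos a≤b b≤n 2≤
  Θ-pos (suc m) {a} {b} a≤b b≤n 3+m≤ with a <? b
  ... | no  a≮b = subst (0 <_) (sym (Θ-unfold-≥ m (≮⇒≥ a≮b))) (Θ¹-pos a≤b b≤n 2≤)
    where 2≤ = ≤-trans (s≤s (s≤s z≤n)) 3+m≤
  ... | yes a<b = subst (0 <_) (sym (Θ-unfold-< m a<b))
                    (⊓-glb (Θ¹-pos a≤b b≤n 2≤) (minUpTo-glb (cutAt m a b) (b ∸ suc a) cut-pos))
    where
    2≤ = ≤-trans (s≤s (s≤s z≤n)) 3+m≤
    cut-pos : ∀ {d} → d ≤ b ∸ suc a → 0 < cutAt m a b d
    cut-pos {d} d≤ = by-first-part (2 ≤? posCountOn a (a + d))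
      where
      a+d<b : a + d < b
      a+d<b = ≤-trans (+-monoʳ-≤ (suc a) d≤) (≤-reflexive (m+[n∸m]≡n a<b))
      by-first-part : Dec (2 ≤ posCountOn a (a + d)) → 0 < cutAt m a b d
      by-first-part (yes 2≤first) = ≤-trans (Θ¹-pos (m≤m+n a d) (≤-trans (<⇒≤ a+d<b) b≤n) 2≤first) (m≤m⊔n _ _)
      by-first-part (no  2≰first) =
        ≤-trans (Θ-pos m a+d<b b≤n (posCountOn-after (m≤m+n a d) a+d<b 3+m≤ (≤-pred (≰⇒> 2≰first))))
                (m≤n⊔m _ _)

theorem5 : ∀ {n : ℕ} (P : DynPath n) (k : ℕ) → 1 < k → k < n → k + 1 ≤ posCount P →
    Σ ℕ (λ t → t < n
      × (∀ i → i ≤ t → Θ¹ P 0 i < Θ P (k ∸ 1) (suc i) n)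
      × (∀ i → t < i → i < n → Θ P (k ∸ 1) (suc i) n ≤ Θ¹ P 0 i)
      × Θ P k 0 n ≡ Θ¹ P 0 (suc t) ⊓ Θ P (k ∸ 1) (suc t) n)
theorem5 {suc N} P (suc (suc m)) (s≤s (s≤s _)) _ k+1≤posCount = crossing F G N F-mono G-anti F0<G0
  where
  F G : ℕ → ℕ
  F i = Θ¹ P 0 i
  G i = Θ P (suc m) (suc i) (suc N)

  F-mono : ∀ {i j} → i ≤ j → j ≤ suc N → F i ≤ F j
  F-mono = stepwise _≤_ ≤-refl ≤-trans F (λ _ → Θ¹-extendʳ P z≤n)

  G-anti : ∀ {i j} → i ≤ j → j ≤ N → G j ≤ G i
  G-anti = stepwise _≥_ ≤-refl (flip ≤-trans) G (λ i<N → Θ-dropˡ P m (s≤s i<N))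

  F0<G0 : F 0 < G 0
  F0<G0 = subst (_< G 0) (sym (Θ¹-single P 0)) (Θ-pos P m (s≤s z≤n) ≤-refl
            (posCountOn-after P z≤n (s≤s z≤n) (subst (_≤ posCount P) (+-comm _ 1) k+1≤posCount)
               (posCountOn-single P 0)))
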